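{- Let $m\ge1$ and $0\le k\le m$. The generating function (with respect to length $n$) of the number of words of length $n$ on $\{1,\dots,m\}$ that avoid both generalized patterns $1-11$ and $1-12$ and have exactly $k$ distinct letters is \[ \binom{m}{k}(1+x)^k\,C_k(x), \] where $C_0(x)=1$ and, for $k\ge1$, $C_k(x)=\sum_{n\ge0}c_{n,k}x^n$ with $c_{n,k}$ the number of words of length $n$ on $\{1,\dots,k\}$ in which every letter of $\{1,\dots,k\}$ occurs, which avoid $1-11$ and $1-12$, and whose last letter occurs nowhere else in the word.
   Context: Words are finite sequences $w_1\cdots w_n$ over a totally ordered alphabet. A word $w$ contains the generalized pattern $1-11$ iff there exist indices $1\le i<j<n$ with $w_i=w_j=w_{j+1}$, and contains $1-12$ iff there exist $i<j<n$ with $w_i=w_j<w_{j+1}$; it avoids a pattern if it does not contain it. -}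

module Defs where

open import Data.Nat using (ℕ; zero; suc; _*_; _∸_; _<?_) renaming (_<_ to _<ℕ_)
open import Data.Nat.Combinatorics using (_C_)
open import Data.Fin using (Fin; toℕ) renaming (_<_ to _<F_)
open import Data.Fin.Properties using (any?; all?) renaming (_≟_ to _≟F_; _<?_ to _<F?_)
open import Data.Vec using (Vec; []; _∷_; lookup)
open import Data.Vec.Membership.Propositional using (_∈_)
import Data.Vec.Membership.DecPropositional as DM
open import Data.List using (List; []; _∷_; length; filter; map; concatMap; upTo; allFin)
open import Data.Product using (Σ; ∃; _×_; _,_)
open import Relation.Nullary using (¬_; Dec; yes; no)
open import Relation.Nullary.Decidable using (_×-dec_; _→-dec_; ¬?)
open import Relation.Binary.PropositionalEquality using (_≡_; _≢_)
import Data.Nat.Properties as ℕP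
open import Data.Nat.ListAction using (sum)

-- All words of length n over the alphabet Fin m = {1,...,m} (letter a ↔ toℕ a + 1).
allWords : (m n : ℕ) → List (Vec (Fin m) n)
allWords m zero    = [] ∷ []
allWords m (suc n) = concatMap (λ a → map (a ∷_) (allWords m n)) (allFin m)

Contains1-11 : ∀ {m n} → Vec (Fin m) n → Set
Contains1-11 {m} {n} w =
  ∃ λ (i : Fin n) → ∃ λ (j : Fin n) → ∃ λ (j' : Fin n) →
    (toℕ i <ℕ toℕ j × suc (toℕ j) ≡ toℕ j') × (lookup w i ≡ lookup w j × lookup w j ≡ lookup w j')

Contains1-12 : ∀ {m n} → Vec (Fin m) n → Set
Contains1-12 {m} {n} w =
  ∃ λ (i : Fin n) → ∃ λ (j : Fin n) → ∃ λ (j' : Fin n) →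
    (toℕ i <ℕ toℕ j × suc (toℕ j) ≡ toℕ j') × (lookup w i ≡ lookup w j × lookup w j <F lookup w j')

contains1-11? : ∀ {m n} (w : Vec (Fin m) n) → Dec (Contains1-11 w)
contains1-11? w = any? λ i → any? λ j → any? λ j' →
  ((toℕ i <? toℕ j) ×-dec (suc (toℕ j) ℕP.≟ toℕ j'))
  ×-dec ((lookup w i ≟F lookup w j) ×-dec (lookup w j ≟F lookup w j'))

contains1-12? : ∀ {m n} (w : Vec (Fin m) n) → Dec (Contains1-12 w)
contains1-12? w = any? λ i → any? λ j → any? λ j' →
  ((toℕ i <? toℕ j) ×-dec (suc (toℕ j) ℕP.≟ toℕ j'))
  ×-dec ((lookup w i ≟F lookup w j) ×-dec (lookup w j <F? lookup w j'))

Avoids : ∀ {m n} → Vec (Fin m) n → Set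
Avoids w = ¬ Contains1-11 w × ¬ Contains1-12 w

avoids? : ∀ {m n} (w : Vec (Fin m) n) → Dec (Avoids w)
avoids? w = ¬? (contains1-11? w) ×-dec ¬? (contains1-12? w)

distinct : ∀ {m n} → Vec (Fin m) n → ℕ
distinct {m} w = length (filter (λ a → DM._∈?_ _≟F_ a w) (allFin m))

Good : ∀ {m n} → ℕ → Vec (Fin m) n → Set
Good k w = Avoids w × distinct w ≡ k

good? : ∀ {m n} (k : ℕ) (w : Vec (Fin m) n) → Dec (Good k w)
good? k w = avoids? w ×-dec (distinct w ℕP.≟ k)

countWords : (m k n : ℕ) → ℕ
countWords m k n = length (filter (good? k) (allWords m n))

Surjective : ∀ {m n} → Vec (Fin m) n → Set
Surjective {m} w = ∀ (a : Fin m) → a ∈ w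

LastUnique : ∀ {m n} → Vec (Fin m) n → Set
LastUnique {m} {n} w = ∀ (i j : Fin n) → suc (toℕ j) ≡ n → i ≢ j → lookup w i ≢ lookup w j

CGood : ∀ {m n} → Vec (Fin m) n → Set
CGood w = Surjective w × Avoids w × LastUnique w

cgood? : ∀ {m n} (w : Vec (Fin m) n) → Dec (CGood w)
cgood? {m} {n} w =
  all? (λ a → DM._∈?_ _≟F_ a w) ×-dec (avoids? w ×-dec
    all? λ i → all? λ j → (suc (toℕ j) ℕP.≟ n) →-dec (¬? (i ≟F j) →-dec ¬? (lookup w i ≟F lookup w j)))

c : (n k : ℕ) → ℕ
c zero    zero    = 1
c (suc n) zero    = 0
c n       (suc k) = length (filter cgood? (allWords (suc k) n))

conv : (ℕ → ℕ) → (ℕ → ℕ) → ℕ → ℕ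
conv f g n = sum (map (λ j → f j * g (n ∸ j)) (upTo (suc n)))

-- [x^n] of binom(m,k) (1+x)^k C_k(x); [x^j](1+x)^k = k C j (zero for j > k)
rhsCoeff : (m k n : ℕ) → ℕ
rhsCoeff m k n = (m C k) * conv (λ j → k C j) (λ i → c i k) n

module Submission where

-- Together the two patterns forbid a "repeat-rise": a letter that already occurred, immediately
-- followed by a letter that is not smaller.  Avoidance is invariant under order-preserving relabelling, so
--   a(m,k,n) = binom(m,k) s(k,n), with s(k,n) counting the avoiding words onto k letters.  We count
--   words that also contain the first j letters; deciding whether letter j occurs gives Pascal's
--   recursion in (m,j).
-- (II) The factor (1+x)^k.  For K ≥ 1, G(n,b) counts avoiding onto words of length n whose last
--   letter is new or a repeat ≥ b.  Deleting the last letter gives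
--   G(n+1,b) = c(n+1,K) + Σ_{b ≤ z < K} G(n,z+1), solved by G(n,b) = Σ_j binom(K-b,j) c(n-j,K).

open import Defs
open import Data.Nat using (ℕ; zero; suc; _+_; _*_; _∸_; _≤_; _<_; z≤n; s≤s; z<s; _≤?_; _<?_)
import Data.Nat.Properties as NP
open import Data.Nat.Combinatorics using (_C_; nCk+nC[k+1]≡[n+1]C[k+1])
open import Data.Nat.ListAction using (sum)
open import Data.Nat.ListAction.Properties using (sum-++)
open import Algebra.Properties.Semiring.Sum NP.+-*-semiring
  using (sum-syntax; sum-cong-≗; ∑-distrib-+; ∑-comm; sum-remove; sum-replicate-zero; *-distribˡ-sum)
  renaming (sum to ∑)
open import Data.Fin as F using (Fin; toℕ; fromℕ; fromℕ<; inject₁; punchIn; punchOut)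
import Data.Fin.Properties as FP
open import Data.Vec as V using (Vec; []; _∷_; lookup; _∷ʳ_)
import Data.Vec.Properties as VP
open import Data.Vec.Relation.Unary.Any as Any using (here; there)
import Data.Vec.Relation.Unary.Any.Properties as AnyP
open import Data.Vec.Membership.Propositional using (_∈_; _∉_)
open import Data.Vec.Membership.Propositional.Properties using (∈-lookup; ∈-map⁺)
import Data.Vec.Membership.DecPropositional as DecMembership
open import Data.List as L using (List; []; _∷_; length; filter; concatMap; allFin; tabulate)
import Data.List.Properties as LP
open import Data.List.Relation.Unary.All.Properties using (tabulate⁺)
open import Data.Product using (∃; _×_; _,_; proj₁; proj₂)
open import Data.Sum using (_⊎_; inj₁; inj₂)
open import Function using (_∘_; id; _⇔_; mk⇔; Equivalence; case_of_)
open Equivalence using (to; from)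
open import Relation.Nullary using (¬_; Dec; yes; no; contradiction)
open import Relation.Nullary.Decidable using (_×-dec_; _→-dec_; ¬?)
open import Relation.Unary using (Pred; Decidable)
open import Relation.Binary.PropositionalEquality
open ≡-Reasoning

𝟙 : ∀ {p} {P : Set p} → Dec P → ℕ
𝟙 (yes _) = 1
𝟙 (no _)  = 0

module _ {p} {P : Set p} where

  𝟙-yes : (d : Dec P) → P → 𝟙 d ≡ 1
  𝟙-yes (yes _) _ = refl
  𝟙-yes (no ¬x) x = contradiction x ¬x

  𝟙-no : (d : Dec P) → ¬ P → 𝟙 d ≡ 0
  𝟙-no (yes x) ¬x = contradiction x ¬x
  𝟙-no (no _)  _  = refl

module _ {p q} {P : Set p} {Q : Set q} where

  𝟙-cong : (d : Dec P) (e : Dec Q) → P ⇔ Q → 𝟙 d ≡ 𝟙 e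
  𝟙-cong (yes _) (yes _) _   = refl
  𝟙-cong (yes x) (no ¬y) P⇔Q = contradiction (to P⇔Q x) ¬y
  𝟙-cong (no ¬x) (yes y) P⇔Q = contradiction (from P⇔Q y) ¬x
  𝟙-cong (no _)  (no _)  _   = refl

  𝟙-× : (d : Dec P) (e : Dec Q) → 𝟙 (d ×-dec e) ≡ 𝟙 d * 𝟙 e
  𝟙-× (yes _) (yes _) = refl
  𝟙-× (yes _) (no _)  = refl
  𝟙-× (no _)  _       = refl

  𝟙-→ : (d : Dec P) (e : Dec Q) → 𝟙 (d →-dec e) ≡ 𝟙 (¬? d) + 𝟙 d * 𝟙 e
  𝟙-→ (yes _) (yes _) = refl
  𝟙-→ (yes _) (no _)  = refl
  𝟙-→ (no _)  _       = refl

  𝟙-split : (d : Dec P) (e : Dec Q) → 𝟙 d ≡ 𝟙 (¬? e) * 𝟙 d + 𝟙 (d ×-dec e)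
  𝟙-split (yes _) (yes _) = refl
  𝟙-split (yes _) (no _)  = refl
  𝟙-split (no _)  (yes _) = refl
  𝟙-split (no _)  (no _)  = refl

+-move-middle : ∀ a x y → a + (x + y) ≡ (a + y) + x
+-move-middle a x y = trans (cong (a +_) (NP.+-comm x y)) (sym (NP.+-assoc a y x))

-- Finite sums over Fin n.  The length is passed explicitly to ∑-cong since a sum does not
-- determine it.
∑-cong : ∀ n {f g : Fin n → ℕ} → (∀ i → f i ≡ g i) → ∑[ i < n ] f i ≡ ∑[ i < n ] g i
∑-cong n = sum-cong-≗

∑-mono : ∀ n {f g : Fin n → ℕ} → (∀ i → f i ≤ g i) → ∑[ i < n ] f i ≤ ∑[ i < n ] g i
∑-mono zero    f≤g = z≤n
∑-mono (suc n) f≤g = NP.+-mono-≤ (f≤g F.zero) (∑-mono n (f≤g ∘ F.suc))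

∑-below : ∀ n j → j ≤ n → ∑[ i < n ] 𝟙 (toℕ i <? j) ≡ j
∑-below n       zero    _         = begin
  ∑[ i < n ] 𝟙 (toℕ i <? 0) ≡⟨ ∑-cong n (λ i → 𝟙-no (toℕ i <? 0) λ ()) ⟩
  ∑[ i < n ] 0              ≡⟨ sum-replicate-zero n ⟩
  0                         ∎
∑-below (suc n) (suc j) (s≤s j≤n) = cong suc (begin
  ∑[ i < n ] 𝟙 (suc (toℕ i) <? suc j) ≡⟨ ∑-cong n (λ i → 𝟙-cong (suc (toℕ i) <? suc j) (toℕ i <? j)
                                                                (mk⇔ NP.≤-pred s≤s)) ⟩
  ∑[ i < n ] 𝟙 (toℕ i <? j)           ≡⟨ ∑-below n j j≤n ⟩
  j                                   ∎)

length-filter≡sum : ∀ {a ℓ} {A : Set a} {P : Pred A ℓ} (P? : Decidable P) (xs : List A) →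
                    length (filter P? xs) ≡ sum (L.map (𝟙 ∘ P?) xs)
length-filter≡sum P? []       = refl
length-filter≡sum P? (x ∷ xs) with P? x
... | yes _ = cong suc (length-filter≡sum P? xs)
... | no _  = length-filter≡sum P? xs

module _ {A B : Set} where

  sum-map-concatMap : (f : B → ℕ) (g : A → List B) (xs : List A) →
                      sum (L.map f (concatMap g xs)) ≡ sum (L.map (λ x → sum (L.map f (g x))) xs)
  sum-map-concatMap f g []       = refl
  sum-map-concatMap f g (x ∷ xs) = begin
    sum (L.map f (g x L.++ concatMap g xs))
      ≡⟨ cong sum (LP.map-++ f (g x) (concatMap g xs)) ⟩
    sum (L.map f (g x) L.++ L.map f (concatMap g xs))
      ≡⟨ sum-++ (L.map f (g x)) _ ⟩
    sum (L.map f (g x)) + sum (L.map f (concatMap g xs))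
      ≡⟨ cong (sum (L.map f (g x)) +_) (sum-map-concatMap f g xs) ⟩
    sum (L.map (λ x → sum (L.map f (g x))) (x ∷ xs)) ∎

  sum-map-map : (f : B → ℕ) (g : A → B) (xs : List A) → sum (L.map f (L.map g xs)) ≡ sum (L.map (f ∘ g) xs)
  sum-map-map f g xs = cong sum (sym (LP.map-∘ xs))

sum-map-tabulate : ∀ {A : Set} n (f : A → ℕ) (g : Fin n → A) → sum (L.map f (tabulate g)) ≡ ∑[ i < n ] f (g i)
sum-map-tabulate zero    f g = refl
sum-map-tabulate (suc n) f g = cong (f (g F.zero) +_) (sum-map-tabulate n f (g ∘ F.suc))

sum-map-upTo : ∀ n (f : ℕ → ℕ) → sum (L.map f (L.upTo n)) ≡ ∑[ i < n ] f (toℕ i)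
sum-map-upTo n f = shifted n id
  where
  shifted : ∀ n (g : ℕ → ℕ) → sum (L.map f (L.applyUpTo g n)) ≡ ∑[ i < n ] f (g (toℕ i))
  shifted zero    g = refl
  shifted (suc n) g = cong (f (g 0) +_) (shifted n (g ∘ suc))

conv≡∑ : ∀ f g n → conv f g n ≡ ∑[ j < suc n ] (f (toℕ j) * g (n ∸ toℕ j))
conv≡∑ f g n = sum-map-upTo (suc n) (λ j → f j * g (n ∸ j))

sumWords : (m n : ℕ) → (Vec (Fin m) n → ℕ) → ℕ
sumWords m zero    f = f []
sumWords m (suc n) f = ∑[ a < m ] sumWords m n (λ w → f (a ∷ w))

sum-allWords : ∀ m n (f : Vec (Fin m) n → ℕ) → sum (L.map f (allWords m n)) ≡ sumWords m n f
sum-allWords m zero    f = NP.+-identityʳ (f [])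
sum-allWords m (suc n) f = begin
  sum (L.map f (concatMap (λ a → L.map (a ∷_) (allWords m n)) (allFin m)))
    ≡⟨ sum-map-concatMap f (λ a → L.map (a ∷_) (allWords m n)) (allFin m) ⟩
  sum (L.map (λ a → sum (L.map f (L.map (a ∷_) (allWords m n)))) (allFin m))
    ≡⟨ sum-map-tabulate m _ id ⟩
  ∑[ a < m ] sum (L.map f (L.map (a ∷_) (allWords m n)))
    ≡⟨ ∑-cong m (λ a → trans (sum-map-map f (a ∷_) (allWords m n)) (sum-allWords m n (f ∘ (a ∷_)))) ⟩
  sumWords m (suc n) f ∎

count-allWords : ∀ m n {ℓ} {P : Pred (Vec (Fin m) n) ℓ} (P? : Decidable P) →
                 length (filter P? (allWords m n)) ≡ sumWords m n (𝟙 ∘ P?)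
count-allWords m n P? = trans (length-filter≡sum P? (allWords m n)) (sum-allWords m n (𝟙 ∘ P?))

module _ (m : ℕ) where

  sumWords-cong : ∀ n {f g : Vec (Fin m) n → ℕ} → (∀ w → f w ≡ g w) → sumWords m n f ≡ sumWords m n g
  sumWords-cong zero    f≗g = f≗g []
  sumWords-cong (suc n) f≗g = ∑-cong m (λ a → sumWords-cong n (f≗g ∘ (a ∷_)))

  sumWords-+ : ∀ n (f g : Vec (Fin m) n → ℕ) →
               sumWords m n (λ w → f w + g w) ≡ sumWords m n f + sumWords m n g
  sumWords-+ zero    f g = refl
  sumWords-+ (suc n) f g = trans (∑-cong m (λ a → sumWords-+ n (f ∘ (a ∷_)) (g ∘ (a ∷_))))
    (∑-distrib-+ (λ a → sumWords m n (f ∘ (a ∷_))) (λ a → sumWords m n (g ∘ (a ∷_))))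

  sumWords-zero : ∀ n → sumWords m n (λ _ → 0) ≡ 0
  sumWords-zero zero    = refl
  sumWords-zero (suc n) = begin
    ∑[ a < m ] sumWords m n (λ _ → 0) ≡⟨ ∑-cong m (λ _ → sumWords-zero n) ⟩
    ∑[ a < m ] 0                      ≡⟨ sum-replicate-zero m ⟩
    0                                 ∎

  sumWords-𝟙-empty : ∀ n {ℓ} {P : Pred (Vec (Fin m) n) ℓ} (P? : Decidable P) → (∀ w → ¬ P w) →
                     sumWords m n (𝟙 ∘ P?) ≡ 0
  sumWords-𝟙-empty n P? ¬P = trans (sumWords-cong n (λ w → 𝟙-no (P? w) (¬P w))) (sumWords-zero n)

  sumWords-*ˡ : ∀ n c (f : Vec (Fin m) n → ℕ) → sumWords m n (λ w → c * f w) ≡ c * sumWords m n f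
  sumWords-*ˡ zero    c f = refl
  sumWords-*ˡ (suc n) c f = trans (∑-cong m (λ a → sumWords-*ˡ n c (f ∘ (a ∷_))))
    (sym (*-distribˡ-sum c (λ a → sumWords m n (f ∘ (a ∷_)))))

  sumWords-∑-comm : ∀ n k (f : Vec (Fin m) n → Fin k → ℕ) →
                    sumWords m n (λ w → ∑[ b < k ] f w b) ≡ ∑[ b < k ] sumWords m n (λ w → f w b)
  sumWords-∑-comm zero    k f = refl
  sumWords-∑-comm (suc n) k f = trans (∑-cong m (λ a → sumWords-∑-comm n k (f ∘ (a ∷_))))
    (∑-comm (λ a b → sumWords m n (λ w → f (a ∷ w) b)))

  sumWords-∷ʳ : ∀ n (f : Vec (Fin m) (suc n) → ℕ) →
                sumWords m (suc n) f ≡ sumWords m n (λ v → ∑[ z < m ] f (v ∷ʳ z))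
  sumWords-∷ʳ zero    f = refl
  sumWords-∷ʳ (suc n) f = ∑-cong m (λ a → sumWords-∷ʳ n (f ∘ (a ∷_)))

_∈?_ : ∀ {m n} (a : Fin m) (w : Vec (Fin m) n) → Dec (a ∈ w)
a ∈? w = DecMembership._∈?_ FP._≟_ a w

∈⇒position : ∀ {A : Set} {n} {a : A} {w : Vec A n} → a ∈ w → ∃ λ i → lookup w i ≡ a
∈⇒position a∈w = Any.index a∈w , sym (AnyP.lookup-index a∈w)

position⇒∈ : ∀ {A : Set} {n} {a : A} (w : Vec A n) (i : Fin n) → lookup w i ≡ a → a ∈ w
position⇒∈ w i refl = ∈-lookup i w

∈-∷ʳ⁻ : ∀ {A : Set} {n} {a : A} (v : Vec A n) z → a ∈ v ∷ʳ z → a ∈ v ⊎ a ≡ z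
∈-∷ʳ⁻ []      z (here a≡z) = inj₂ a≡z
∈-∷ʳ⁻ (x ∷ v) z (here a≡x) = inj₁ (here a≡x)
∈-∷ʳ⁻ (x ∷ v) z (there a∈) with ∈-∷ʳ⁻ v z a∈
... | inj₁ a∈v = inj₁ (there a∈v)
... | inj₂ a≡z = inj₂ a≡z

∈-∷ʳ⁺ : ∀ {A : Set} {n} {a : A} (v : Vec A n) z → a ∈ v → a ∈ v ∷ʳ z
∈-∷ʳ⁺ (x ∷ v) z (here a≡x) = here a≡x
∈-∷ʳ⁺ (x ∷ v) z (there a∈) = there (∈-∷ʳ⁺ v z a∈)

module _ {m} (p : Fin (suc m)) where

  ∉-punchIn : ∀ {n} (w : Vec (Fin m) n) → p ∉ V.map (punchIn p) w
  ∉-punchIn w p∈ with Any.satisfied (AnyP.map⁻ p∈)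
  ... | a , p≡pₐ = FP.punchInᵢ≢i p a (sym p≡pₐ)

  ∈-punchIn⁻ : ∀ {n} (w : Vec (Fin m) n) b → punchIn p b ∈ V.map (punchIn p) w → b ∈ w
  ∈-punchIn⁻ w b b∈ = Any.map (FP.punchIn-injective p b _) (AnyP.map⁻ b∈)

  -- Words on m+1 letters missing p are exactly the relabelled words on m letters.
  sumWords-∉ : ∀ n (f : Vec (Fin (suc m)) n → ℕ) →
               sumWords (suc m) n (λ w → 𝟙 (¬? (p ∈? w)) * f w) ≡ sumWords m n (f ∘ V.map (punchIn p))
  sumWords-∉ zero    f = NP.+-identityʳ (f [])
  sumWords-∉ (suc n) f = begin
    ∑[ a < suc m ] starting a                              ≡⟨ sum-remove {i = p} starting ⟩
    starting p + ∑[ b < m ] starting (punchIn p b)         ≡⟨ cong₂ _+_ starting-p (∑-cong m starting-other) ⟩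
    0 + ∑[ b < m ] sumWords m n (λ w → f (punchIn p b ∷ V.map (punchIn p) w)) ∎
    where
    starting : Fin (suc m) → ℕ
    starting a = sumWords (suc m) n (λ w → 𝟙 (¬? (p ∈? (a ∷ w))) * f (a ∷ w))

    starting-p : starting p ≡ 0
    starting-p = trans (sumWords-cong (suc m) n (λ w → cong (_* f (p ∷ w))
                         (𝟙-no (¬? (p ∈? (p ∷ w))) (λ p∉ → p∉ (here refl)))))
                       (sumWords-zero (suc m) n)

    ∉-∷ : ∀ {n} b (w : Vec (Fin (suc m)) n) → p ∉ w → p ∉ punchIn p b ∷ w
    ∉-∷ b w p∉w (here p≡)  = FP.punchInᵢ≢i p b (sym p≡)
    ∉-∷ b w p∉w (there p∈) = p∉w p∈

    starting-other : ∀ b → starting (punchIn p b) ≡ sumWords m n (λ w → f (punchIn p b ∷ V.map (punchIn p) w))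
    starting-other b = trans (sumWords-cong (suc m) n (λ w → cong (_* f (punchIn p b ∷ w))
                               (𝟙-cong (¬? (p ∈? (punchIn p b ∷ w))) (¬? (p ∈? w))
                                       (mk⇔ (_∘ there) (∉-∷ b w)))))
                             (sumWords-∉ n (f ∘ (punchIn p b ∷_)))

punchIn-below : ∀ {m} (p : Fin (suc m)) (a : Fin m) → toℕ a < toℕ p → toℕ (punchIn p a) ≡ toℕ a
punchIn-below (F.suc p) F.zero    _         = refl
punchIn-below (F.suc p) (F.suc a) (s≤s a<p) = cong suc (punchIn-below p a a<p)

punchIn-≥ : ∀ {m} (p : Fin (suc m)) (a : Fin m) → toℕ a ≤ toℕ (punchIn p a)
punchIn-≥ F.zero    a         = NP.n≤1+n (toℕ a)
punchIn-≥ (F.suc p) F.zero    = z≤n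
punchIn-≥ (F.suc p) (F.suc a) = s≤s (punchIn-≥ p a)

distinct≡∑ : ∀ {m n} (w : Vec (Fin m) n) → distinct w ≡ ∑[ a < m ] 𝟙 (a ∈? w)
distinct≡∑ {m} w = trans (length-filter≡sum (_∈? w) (allFin m)) (sum-map-tabulate m (𝟙 ∘ (_∈? w)) id)

distinct-punchIn : ∀ {m n} (p : Fin (suc m)) (w : Vec (Fin m) n) → distinct (V.map (punchIn p) w) ≡ distinct w
distinct-punchIn {m} p w = begin
  distinct w′                                     ≡⟨ distinct≡∑ w′ ⟩
  ∑[ a < suc m ] 𝟙 (a ∈? w′)                      ≡⟨ sum-remove {i = p} (λ a → 𝟙 (a ∈? w′)) ⟩
  𝟙 (p ∈? w′) + ∑[ b < m ] 𝟙 (punchIn p b ∈? w′)  ≡⟨ cong₂ _+_ (𝟙-no (p ∈? w′) (∉-punchIn p w))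
                                                              (∑-cong m relabelled) ⟩
  ∑[ b < m ] 𝟙 (b ∈? w)                           ≡⟨ distinct≡∑ w ⟨
  distinct w                                      ∎
  where
  w′ = V.map (punchIn p) w
  relabelled : ∀ b → 𝟙 (punchIn p b ∈? w′) ≡ 𝟙 (b ∈? w)
  relabelled b = 𝟙-cong (punchIn p b ∈? w′) (b ∈? w) (mk⇔ (∈-punchIn⁻ p w b) (∈-map⁺ (punchIn p)))

surj? : ∀ {m n} (w : Vec (Fin m) n) → Dec (Surjective w)
surj? w = FP.all? (_∈? w)

surjective⇒distinct : ∀ {m n} (w : Vec (Fin m) n) → Surjective w → distinct w ≡ m
surjective⇒distinct {m} w onto = begin
  length (filter (_∈? w) (allFin m)) ≡⟨ cong length (LP.filter-all (_∈? w) (tabulate⁺ onto)) ⟩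
  length (allFin m)                  ≡⟨ LP.length-tabulate id ⟩
  m                                  ∎

Covers : ∀ {m n} → ℕ → Vec (Fin m) n → Set
Covers j w = ∀ a → toℕ a < j → a ∈ w

covers? : ∀ {m n} j (w : Vec (Fin m) n) → Dec (Covers j w)
covers? j w = FP.all? (λ a → (toℕ a <? j) →-dec (a ∈? w))

covers⇒≤distinct : ∀ {m n} j (w : Vec (Fin m) n) → j ≤ m → Covers j w → j ≤ distinct w
covers⇒≤distinct {m} j w j≤m covered =
  subst₂ _≤_ (∑-below m j j≤m) (sym (distinct≡∑ w)) (∑-mono m below⇒occurs)
  where
  below⇒occurs : ∀ a → 𝟙 (toℕ a <? j) ≤ 𝟙 (a ∈? w)
  below⇒occurs a with toℕ a <? j
  ... | yes a<j = NP.≤-reflexive (sym (𝟙-yes (a ∈? w) (covered a a<j)))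
  ... | no _    = z≤n

covers-punchIn : ∀ {m n} (p : Fin (suc m)) j (w : Vec (Fin m) n) → toℕ p ≡ j →
                 Covers j (V.map (punchIn p) w) ⇔ Covers j w
covers-punchIn p j w refl = mk⇔ restrict extend
  where
  restrict : Covers j (V.map (punchIn p) w) → Covers j w
  restrict covered a a<p =
    ∈-punchIn⁻ p w a (covered (punchIn p a) (subst (_< toℕ p) (sym (punchIn-below p a a<p)) a<p))

  extend : Covers j w → Covers j (V.map (punchIn p) w)
  extend covered b b<p = subst (_∈ V.map (punchIn p) w) b≡pₐ (∈-map⁺ (punchIn p) (covered a a<p))
    where
    p≢b : p ≢ b
    p≢b p≡b = NP.<-irrefl (cong toℕ (sym p≡b)) b<p
    a = punchOut p≢b
    b≡pₐ = FP.punchIn-punchOut p≢b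
    a<p = NP.≤-<-trans (punchIn-≥ p a) (subst (λ x → toℕ x < toℕ p) (sym b≡pₐ) b<p)

covers-suc : ∀ {m n} (p : Fin m) j (w : Vec (Fin m) n) → toℕ p ≡ j →
             Covers (suc j) w ⇔ (Covers j w × p ∈ w)
covers-suc p j w refl = mk⇔
  (λ covered → (λ a a<p → covered a (NP.m≤n⇒m≤1+n a<p)) , covered p (NP.n<1+n (toℕ p)))
  (λ (covered , p∈w) a a≤p → case NP.m≤n⇒m<n∨m≡n (NP.≤-pred a≤p) of λ where
     (inj₁ a<p) → covered a a<p
     (inj₂ a≡p) → subst (_∈ w) (sym (FP.toℕ-injective a≡p)) p∈w)

-- The two patterns merged: RiseAt w i j j′ says that position j repeats the letter at i < j and
-- is followed, at j′ = j+1, by a letter that is not smaller.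
RiseAt : ∀ {m n} → Vec (Fin m) n → Fin n → Fin n → Fin n → Set
RiseAt w i j j′ =
  toℕ i < toℕ j × suc (toℕ j) ≡ toℕ j′ × lookup w i ≡ lookup w j × lookup w j F.≤ lookup w j′

RepeatRise : ∀ {m n} → Vec (Fin m) n → Set
RepeatRise {n = n} w = ∃ λ (i : Fin n) → ∃ λ (j : Fin n) → ∃ λ (j′ : Fin n) → RiseAt w i j j′

avoids⇔noRise : ∀ {m n} (w : Vec (Fin m) n) → Avoids w ⇔ (¬ RepeatRise w)
avoids⇔noRise w = mk⇔ noRise noPattern
  where
  noRise : Avoids w → ¬ RepeatRise w
  noRise (no11 , no12) (i , j , j′ , i<j , j+1≡j′ , wi≡wj , wj≤wj′) with NP.m≤n⇒m<n∨m≡n wj≤wj′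
  ... | inj₁ wj<wj′ = no12 (i , j , j′ , (i<j , j+1≡j′) , wi≡wj , wj<wj′)
  ... | inj₂ wj≡wj′ = no11 (i , j , j′ , (i<j , j+1≡j′) , wi≡wj , FP.toℕ-injective wj≡wj′)

  noPattern : ¬ RepeatRise w → Avoids w
  noPattern ¬rise =
      (λ (i , j , j′ , (i<j , j+1≡j′) , wi≡wj , wj≡wj′) →
          ¬rise (i , j , j′ , i<j , j+1≡j′ , wi≡wj , FP.≤-reflexive wj≡wj′))
    , (λ (i , j , j′ , (i<j , j+1≡j′) , wi≡wj , wj<wj′) →
          ¬rise (i , j , j′ , i<j , j+1≡j′ , wi≡wj , NP.<⇒≤ wj<wj′))

module OrderEmbedding {a b} (f : Fin a → Fin b)
  (mono : ∀ {x y} → x F.≤ y → f x F.≤ f y) (reflect : ∀ {x y} → f x F.≤ f y → x F.≤ y) where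

  injective : ∀ {x y} → f x ≡ f y → x ≡ y
  injective fx≡fy = FP.≤-antisym (reflect (FP.≤-reflexive fx≡fy)) (reflect (FP.≤-reflexive (sym fx≡fy)))

  riseAt-map : ∀ {n} (w : Vec (Fin a) n) i j j′ → RiseAt (V.map f w) i j j′ ⇔ RiseAt w i j j′
  riseAt-map w i j j′
    rewrite VP.lookup-map i f w | VP.lookup-map j f w | VP.lookup-map j′ f w =
    mk⇔ (λ (i<j , j+1≡j′ , eq , le) → i<j , j+1≡j′ , injective eq , reflect le)
        (λ (i<j , j+1≡j′ , eq , le) → i<j , j+1≡j′ , cong f eq , mono le)

  avoids-map : ∀ {n} (w : Vec (Fin a) n) → Avoids (V.map f w) ⇔ Avoids w
  avoids-map w = mk⇔
    (λ av → from (avoids⇔noRise w)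
              (λ (i , j , j′ , r) → to (avoids⇔noRise (V.map f w)) av (i , j , j′ , from (riseAt-map w i j j′) r)))
    (λ av → from (avoids⇔noRise (V.map f w))
              (λ (i , j , j′ , r) → to (avoids⇔noRise w) av (i , j , j′ , to (riseAt-map w i j j′) r)))

avoids-punchIn : ∀ {m n} (p : Fin (suc m)) (w : Vec (Fin m) n) → Avoids (V.map (punchIn p) w) ⇔ Avoids w
avoids-punchIn p = OrderEmbedding.avoids-map (punchIn p) (FP.punchIn-mono-≤ p _ _) (FP.punchIn-cancel-≤ p _ _)

lookup-∷ʳ-old : ∀ {A : Set} {n} (w : Vec A n) z (i : Fin n) → lookup (w ∷ʳ z) (inject₁ i) ≡ lookup w i
lookup-∷ʳ-old (x ∷ w) z F.zero    = refl
lookup-∷ʳ-old (x ∷ w) z (F.suc i) = lookup-∷ʳ-old w z i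

lookup-∷ʳ-last : ∀ {A : Set} {n} (w : Vec A n) z → lookup (w ∷ʳ z) (fromℕ n) ≡ z
lookup-∷ʳ-last []      z = refl
lookup-∷ʳ-last (x ∷ w) z = lookup-∷ʳ-last w z

old-position : ∀ {n} (i : Fin (suc n)) → toℕ i < n → ∃ λ i₀ → i ≡ inject₁ i₀
old-position i i<n = F.lower₁ i n≢i , sym (FP.inject₁-lower₁ i n≢i)
  where n≢i = NP.>⇒≢ i<n

last-position : ∀ {n} (i : Fin (suc n)) → toℕ i ≡ n → i ≡ fromℕ n
last-position {n} i i≡n = FP.toℕ-injective (trans i≡n (sym (FP.toℕ-fromℕ n)))

LastRiseAt : ∀ {m n} → Vec (Fin m) n → Fin m → Fin n → Fin n → Set
LastRiseAt {n = n} w z i j = toℕ i < toℕ j × suc (toℕ j) ≡ n × lookup w i ≡ lookup w j × lookup w j F.≤ z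

LastRepeat≤ : ∀ {m n} → Vec (Fin m) n → Fin m → Set
LastRepeat≤ {n = n} w z = ∃ λ (i : Fin n) → ∃ λ (j : Fin n) → LastRiseAt w z i j

module _ {m n} (w : Vec (Fin m) n) (z : Fin m) where

  riseAt-∷ʳ-old : ∀ i j j′ → RiseAt (w ∷ʳ z) (inject₁ i) (inject₁ j) (inject₁ j′) ≡ RiseAt w i j j′
  riseAt-∷ʳ-old i j j′
    rewrite FP.toℕ-inject₁ i | FP.toℕ-inject₁ j | FP.toℕ-inject₁ j′
          | lookup-∷ʳ-old w z i | lookup-∷ʳ-old w z j | lookup-∷ʳ-old w z j′ = refl

  riseAt-∷ʳ-last : ∀ i j → RiseAt (w ∷ʳ z) (inject₁ i) (inject₁ j) (fromℕ n) ≡ LastRiseAt w z i j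
  riseAt-∷ʳ-last i j
    rewrite FP.toℕ-inject₁ i | FP.toℕ-inject₁ j | FP.toℕ-fromℕ n
          | lookup-∷ʳ-old w z i | lookup-∷ʳ-old w z j | lookup-∷ʳ-last w z = refl

  repeatRise-∷ʳ : RepeatRise (w ∷ʳ z) ⇔ (RepeatRise w ⊎ LastRepeat≤ w z)
  repeatRise-∷ʳ = mk⇔ split join
    where
    split : RepeatRise (w ∷ʳ z) → RepeatRise w ⊎ LastRepeat≤ w z
    split (i , j , j′ , r@(i<j , j+1≡j′ , _))
      with j<n ← NP.<-≤-trans (NP.≤-reflexive j+1≡j′) (NP.≤-pred (FP.toℕ<n j′))
      with old-position j j<n | old-position i (NP.<-trans i<j j<n)
         | NP.m≤n⇒m<n∨m≡n (NP.≤-pred (FP.toℕ<n j′))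
    ... | j₀ , refl | i₀ , refl | inj₁ j′<n with old-position j′ j′<n
    ...   | j′₀ , refl = inj₁ (i₀ , j₀ , j′₀ , subst id (riseAt-∷ʳ-old i₀ j₀ j′₀) r)
    split (i , j , j′ , r) | j₀ , refl | i₀ , refl | inj₂ j′≡n with last-position j′ j′≡n
    ...   | refl = inj₂ (i₀ , j₀ , subst id (riseAt-∷ʳ-last i₀ j₀) r)

    join : RepeatRise w ⊎ LastRepeat≤ w z → RepeatRise (w ∷ʳ z)
    join (inj₁ (i , j , j′ , r)) = inject₁ i , inject₁ j , inject₁ j′ , subst id (sym (riseAt-∷ʳ-old i j j′)) r
    join (inj₂ (i , j , r))      = inject₁ i , inject₁ j , fromℕ n , subst id (sym (riseAt-∷ʳ-last i j)) r

lastRepeat≤-∷ʳ : ∀ {m n} (v : Vec (Fin m) n) y z → LastRepeat≤ (v ∷ʳ y) z ⇔ (y ∈ v × y F.≤ z)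
lastRepeat≤-∷ʳ {n = n} v y z = mk⇔ split join
  where
  split : LastRepeat≤ (v ∷ʳ y) z → y ∈ v × y F.≤ z
  split (i , j , i<j , j+1≡n+1 , wi≡wj , wj≤z) with last-position j (NP.suc-injective j+1≡n+1)
  ... | refl with old-position i (subst (toℕ i <_) (FP.toℕ-fromℕ n) i<j)
  ...   | i₀ , refl = position⇒∈ v i₀ (trans (sym (lookup-∷ʳ-old v y i₀)) (trans wi≡wj (lookup-∷ʳ-last v y)))
                    , subst (F._≤ z) (lookup-∷ʳ-last v y) wj≤z

  join : y ∈ v × y F.≤ z → LastRepeat≤ (v ∷ʳ y) z
  join (y∈v , y≤z) with ∈⇒position y∈v
  ... | i₀ , vi₀≡y = inject₁ i₀ , fromℕ n
                   , subst₂ _<_ (sym (FP.toℕ-inject₁ i₀)) (sym (FP.toℕ-fromℕ n)) (FP.toℕ<n i₀)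
                   , cong suc (FP.toℕ-fromℕ n)
                   , trans (lookup-∷ʳ-old v y i₀) (trans vi₀≡y (sym (lookup-∷ʳ-last v y)))
                   , subst (F._≤ z) (sym (lookup-∷ʳ-last v y)) y≤z

-- The letter after a repeated letter must drop: (v ∷ʳ y) ∷ʳ z avoids the patterns iff v ∷ʳ y does
-- and z < y in case y occurs in v.
avoids-∷ʳ∷ʳ : ∀ {m n} (v : Vec (Fin m) n) y z →
              Avoids ((v ∷ʳ y) ∷ʳ z) ⇔ (Avoids (v ∷ʳ y) × (y ∈ v → z F.< y))
avoids-∷ʳ∷ʳ v y z = mk⇔ restrict extend
  where
  w  = v ∷ʳ y
  w′ = w ∷ʳ z

  restrict : Avoids w′ → Avoids w × (y ∈ v → z F.< y)
  restrict av = from (avoids⇔noRise w) (¬rise ∘ from (repeatRise-∷ʳ w z) ∘ inj₁)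
              , λ y∈v → NP.≰⇒> λ y≤z → ¬rise (from (repeatRise-∷ʳ w z) (inj₂ (lastRise y∈v y≤z)))
    where
    ¬rise = to (avoids⇔noRise w′) av
    lastRise = λ y∈v y≤z → from (lastRepeat≤-∷ʳ v y z) (y∈v , y≤z)

  extend : Avoids w × (y ∈ v → z F.< y) → Avoids w′
  extend (av , drop) = from (avoids⇔noRise w′) λ rise → case to (repeatRise-∷ʳ w z) rise of λ where
    (inj₁ rise-w)    → to (avoids⇔noRise w) av rise-w
    (inj₂ last-rise) → let (y∈v , y≤z) = to (lastRepeat≤-∷ʳ v y z) last-rise in NP.<⇒≱ (drop y∈v) y≤z

lastUnique-∷ʳ : ∀ {m n} (v : Vec (Fin m) n) z → LastUnique (v ∷ʳ z) ⇔ z ∉ v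
lastUnique-∷ʳ {n = n} v z = mk⇔ unique⇒∉ ∉⇒unique
  where
  unique⇒∉ : LastUnique (v ∷ʳ z) → z ∉ v
  unique⇒∉ unique z∈v with ∈⇒position z∈v
  ... | i₀ , vi₀≡z = unique (inject₁ i₀) (fromℕ n) (cong suc (FP.toℕ-fromℕ n)) (FP.fromℕ≢inject₁ ∘ sym)
                            (trans (lookup-∷ʳ-old v z i₀) (trans vi₀≡z (sym (lookup-∷ʳ-last v z))))

  ∉⇒unique : z ∉ v → LastUnique (v ∷ʳ z)
  ∉⇒unique z∉v i j j+1≡n+1 i≢j wi≡wj with last-position j (NP.suc-injective j+1≡n+1)
  ... | refl with NP.m≤n⇒m<n∨m≡n (NP.≤-pred (FP.toℕ<n i))
  ...   | inj₂ i≡n = i≢j (last-position i i≡n)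
  ...   | inj₁ i<n with old-position i i<n
  ...     | i₀ , refl =
    z∉v (position⇒∈ v i₀ (trans (sym (lookup-∷ʳ-old v z i₀)) (trans wi≡wj (lookup-∷ʳ-last v z))))

onto-∷ʳ : ∀ {m n} (w : Vec (Fin m) n) z → z ∈ w → Surjective (w ∷ʳ z) ⇔ Surjective w
onto-∷ʳ w z z∈w = mk⇔
  (λ onto a → case ∈-∷ʳ⁻ w z (onto a) of λ where
     (inj₁ a∈w)  → a∈w
     (inj₂ refl) → z∈w)
  (λ onto a → ∈-∷ʳ⁺ w z (onto a))

module ChooseAlphabet
  (P : ∀ {m n} → Vec (Fin m) n → Set)
  (P? : ∀ {m n} (w : Vec (Fin m) n) → Dec (P w))
  (P-punchIn : ∀ {m n} (p : Fin (suc m)) (w : Vec (Fin m) n) → P (V.map (punchIn p) w) ⇔ P w)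
  (k n : ℕ) where

  exact? : ∀ {m} (w : Vec (Fin m) n) → Dec (P w × distinct w ≡ k)
  exact? w = P? w ×-dec (distinct w NP.≟ k)

  counted? : ∀ {m} j (w : Vec (Fin m) n) → Dec ((P w × distinct w ≡ k) × Covers j w)
  counted? j w = exact? w ×-dec covers? j w

  Q : ℕ → ℕ → ℕ
  Q m j = sumWords m n (𝟙 ∘ counted? j)

  onto : ℕ
  onto = sumWords k n (λ w → 𝟙 (P? w ×-dec surj? w))

  -- Pascal's recursion: letter j (j ≤ m) is absent — the word is a relabelled word on m letters —
  -- or present, and then the first j+1 letters are covered.
  Q-step : ∀ m j → j ≤ m → Q (suc m) j ≡ Q m j + Q (suc m) (suc j)
  Q-step m j j≤m = begin
    Q (suc m) j
      ≡⟨ sumWords-cong (suc m) n (λ w → 𝟙-split (counted? j w) (p ∈? w)) ⟩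
    sumWords (suc m) n (λ w → without-p w + with-p w)
      ≡⟨ sumWords-+ (suc m) n without-p with-p ⟩
    sumWords (suc m) n without-p + sumWords (suc m) n with-p
      ≡⟨ cong₂ _+_ (trans (sumWords-∉ p n (𝟙 ∘ counted? j)) (sumWords-cong m n relabel))
                   (sumWords-cong (suc m) n include-p) ⟩
    Q m j + Q (suc m) (suc j) ∎
    where
    p : Fin (suc m)
    p = fromℕ< (s≤s j≤m)
    p≡j : toℕ p ≡ j
    p≡j = FP.toℕ-fromℕ< (s≤s j≤m)

    without-p with-p : Vec (Fin (suc m)) n → ℕ
    without-p w = 𝟙 (¬? (p ∈? w)) * 𝟙 (counted? j w)
    with-p    w = 𝟙 (counted? j w ×-dec p ∈? w)

    relabel : ∀ w → 𝟙 (counted? j (V.map (punchIn p) w)) ≡ 𝟙 (counted? j w)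
    relabel w = 𝟙-cong (counted? j (V.map (punchIn p) w)) (counted? j w) (mk⇔
      (λ ((pw , d) , c) → (to (P-punchIn p w) pw , trans (sym (distinct-punchIn p w)) d)
                        , to (covers-punchIn p j w p≡j) c)
      (λ ((pw , d) , c) → (from (P-punchIn p w) pw , trans (distinct-punchIn p w) d)
                        , from (covers-punchIn p j w p≡j) c))

    include-p : ∀ w → with-p w ≡ 𝟙 (counted? (suc j) w)
    include-p w = 𝟙-cong (counted? j w ×-dec p ∈? w) (counted? (suc j) w) (mk⇔
      (λ ((e , c) , p∈w) → e , from (covers-suc p j w p≡j) (c , p∈w))
      (λ (e , c) → let (c′ , p∈w) = to (covers-suc p j w p≡j) c in (e , c′) , p∈w))

  -- Covering all k letters is being onto, which forces exactly k distinct letters.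
  Q-onto : Q k k ≡ onto
  Q-onto = sumWords-cong k n (λ w → 𝟙-cong (counted? k w) (P? w ×-dec surj? w) (mk⇔
    (λ ((pw , _) , covered) → pw , (λ a → covered a (FP.toℕ<n a)))
    (λ (pw , onto-w) → (pw , surjective⇒distinct w onto-w) , (λ a _ → onto-w a))))

  Q-onto-≢ : ∀ m → m ≢ k → Q m m ≡ 0
  Q-onto-≢ m m≢k = sumWords-𝟙-empty m n (counted? m)
    (λ w ((_ , d) , covered) → m≢k (trans (sym (surjective⇒distinct w (λ a → covered a (FP.toℕ<n a)))) d))

  Q-beyond : ∀ m j → k < j → j ≤ m → Q m j ≡ 0
  Q-beyond m j k<j j≤m = sumWords-𝟙-empty m n (counted? j)
    (λ w ((_ , d) , covered) → NP.<⇒≱ k<j (subst (j ≤_) d (covers⇒≤distinct j w j≤m covered)))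

  Q-formula : ∀ r j t → j + t ≡ k → Q (r + j) j ≡ (r C t) * onto
  Q-formula zero    j zero    j+0≡k with trans (sym (NP.+-identityʳ j)) j+0≡k
  ... | refl = trans Q-onto (sym (NP.*-identityˡ onto))
  Q-formula zero    j (suc t) j+t+1≡k = Q-onto-≢ j (NP.<⇒≢ (subst (j <_) j+t+1≡k (NP.m<m+n j z<s)))
  Q-formula (suc r) j zero    j+0≡k with trans (sym (NP.+-identityʳ j)) j+0≡k
  ... | refl = begin
    Q (suc r + j) j                      ≡⟨ Q-step (r + j) j (NP.m≤n+m j r) ⟩
    Q (r + j) j + Q (suc r + j) (suc j)  ≡⟨ cong₂ _+_ (Q-formula r j 0 j+0≡k)
                                                      (Q-beyond (suc r + j) (suc j) (NP.n<1+n j) (s≤s (NP.m≤n+m j r))) ⟩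
    1 * onto + 0                         ≡⟨ NP.+-identityʳ (1 * onto) ⟩
    1 * onto                             ∎
  Q-formula (suc r) j (suc t) j+t+1≡k = begin
    Q (suc r + j) j                      ≡⟨ Q-step (r + j) j (NP.m≤n+m j r) ⟩
    Q (r + j) j + Q (suc r + j) (suc j)  ≡⟨ cong (λ m → Q (r + j) j + Q m (suc j)) (NP.+-suc r j) ⟨
    Q (r + j) j + Q (r + suc j) (suc j)  ≡⟨ cong₂ _+_ (Q-formula r j (suc t) j+t+1≡k)
                                                      (Q-formula r (suc j) t (trans (sym (NP.+-suc j t)) j+t+1≡k)) ⟩
    (r C suc t) * onto + (r C t) * onto  ≡⟨ NP.*-distribʳ-+ onto (r C suc t) (r C t) ⟨
    (r C suc t + r C t) * onto           ≡⟨ cong (_* onto) (trans (NP.+-comm (r C suc t) (r C t))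
                                                                  (nCk+nC[k+1]≡[n+1]C[k+1] r t)) ⟩
    (suc r C suc t) * onto               ∎

  -- Every word covers its first 0 letters, so the count sought is Q m 0 = binom(m,k) · onto.
  count-exact : ∀ m → sumWords m n (𝟙 ∘ exact?) ≡ (m C k) * onto
  count-exact m = begin
    sumWords m n (𝟙 ∘ exact?)  ≡⟨ sumWords-cong m n (λ w → 𝟙-cong (exact? w) (counted? 0 w)
                                                                  (mk⇔ (_, λ _ ()) proj₁)) ⟩
    Q m 0                      ≡⟨ cong (λ m′ → Q m′ 0) (NP.+-identityʳ m) ⟨
    Q (m + 0) 0                ≡⟨ Q-formula m 0 k refl ⟩
    (m C k) * onto             ∎

avoidsOnto? : ∀ {m n} (w : Vec (Fin m) n) → Dec (Avoids w × Surjective w)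
avoidsOnto? w = avoids? w ×-dec surj? w

ontoCount : ℕ → ℕ → ℕ
ontoCount k n = sumWords k n (𝟙 ∘ avoidsOnto?)

sumFrom : ℕ → (K : ℕ) → (ℕ → ℕ) → ℕ
sumFrom b K g = ∑[ z < K ] (𝟙 (b ≤? toℕ z) * g (toℕ z))

sumFrom-suc : ∀ b K g → sumFrom (suc b) (suc K) g ≡ sumFrom b K (g ∘ suc)
sumFrom-suc b K g = ∑-cong K (λ z → cong (_* g (suc (toℕ z)))
  (𝟙-cong (suc b ≤? suc (toℕ z)) (b ≤? toℕ z) (mk⇔ NP.≤-pred s≤s)))

sumFrom-empty : ∀ b K g → K ≤ b → sumFrom b K g ≡ 0
sumFrom-empty b       zero    g _         = refl
sumFrom-empty (suc b) (suc K) g (s≤s K≤b) = trans (sumFrom-suc b K g) (sumFrom-empty b K (g ∘ suc) K≤b)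

sumFrom-first : ∀ b K g → b < K → sumFrom b K g ≡ g b + sumFrom (suc b) K g
sumFrom-first zero    (suc K) g _         =
  cong₂ _+_ (NP.*-identityˡ (g 0)) (∑-cong K (λ z → cong (_* g (suc (toℕ z)))
    (𝟙-cong (0 ≤? suc (toℕ z)) (1 ≤? suc (toℕ z)) (mk⇔ (λ _ → s≤s z≤n) (λ _ → z≤n)))))
sumFrom-first (suc b) (suc K) g (s≤s b<K) = begin
  sumFrom (suc b) (suc K) g                    ≡⟨ sumFrom-suc b K g ⟩
  sumFrom b K (g ∘ suc)                        ≡⟨ sumFrom-first b K (g ∘ suc) b<K ⟩
  g (suc b) + sumFrom (suc b) K (g ∘ suc)      ≡⟨ cong (g (suc b) +_) (sumFrom-suc (suc b) K g) ⟨
  g (suc b) + sumFrom (suc (suc b)) (suc K) g  ∎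

-- (II) The factor (1+x)^K for K = k+1 ≥ 1 letters.  G n b counts the avoiding onto words of length n
-- whose last letter is new or a repeat ≥ b, so s(K,n) = G n 0 and G n K counts c(n,K).
module OntoWords (k : ℕ) where

  K : ℕ
  K = suc k

  endsFrom : ℕ → ∀ {n} → Vec (Fin K) n → Fin K → ℕ
  endsFrom b v z = 𝟙 (avoidsOnto? (v ∷ʳ z)) * 𝟙 ((z ∈? v) →-dec (b ≤? toℕ z))

  endsNew : ∀ {n} → Vec (Fin K) n → Fin K → ℕ
  endsNew v z = 𝟙 (avoidsOnto? (v ∷ʳ z)) * 𝟙 (¬? (z ∈? v))

  endsRepeat : ℕ → ∀ {n} → Vec (Fin K) n → Fin K → ℕ
  endsRepeat b v z = 𝟙 (avoidsOnto? (v ∷ʳ z)) * (𝟙 (z ∈? v) * 𝟙 (b ≤? toℕ z))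

  G : ℕ → ℕ → ℕ
  G zero    b = 0
  G (suc n) b = sumWords K n (λ v → ∑[ z < K ] endsFrom b v z)

  T : ℕ → ℕ → ℕ
  T n b = sumWords K n (λ v → ∑[ z < K ] endsRepeat b v z)

  empty-not-onto : ¬ Surjective {K} {0} []
  empty-not-onto onto with onto F.zero
  ... | ()

  c-count : ∀ n → c n K ≡ sumWords K n (𝟙 ∘ cgood?)
  c-count zero    = count-allWords K 0 cgood?
  c-count (suc n) = count-allWords K (suc n) cgood?

  c-0 : c 0 K ≡ 0
  c-0 = trans (c-count 0) (𝟙-no (cgood? []) (empty-not-onto ∘ proj₁))

  c-suc : ∀ n → c (suc n) K ≡ sumWords K n (λ v → ∑[ z < K ] endsNew v z)
  c-suc n = begin
    c (suc n) K                                          ≡⟨ c-count (suc n) ⟩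
    sumWords K (suc n) (𝟙 ∘ cgood?)                      ≡⟨ sumWords-∷ʳ K n (𝟙 ∘ cgood?) ⟩
    sumWords K n (λ v → ∑[ z < K ] 𝟙 (cgood? (v ∷ʳ z)))  ≡⟨ sumWords-cong K n (∑-cong K ∘ new-last) ⟩
    sumWords K n (λ v → ∑[ z < K ] endsNew v z)          ∎
    where
    new-last : ∀ {n} (v : Vec (Fin K) n) z → 𝟙 (cgood? (v ∷ʳ z)) ≡ endsNew v z
    new-last v z = trans
      (𝟙-cong (cgood? (v ∷ʳ z)) (avoidsOnto? (v ∷ʳ z) ×-dec ¬? (z ∈? v)) (mk⇔
        (λ (onto , av , unique) → (av , onto) , to (lastUnique-∷ʳ v z) unique)
        (λ ((av , onto) , z∉v) → onto , av , from (lastUnique-∷ʳ v z) z∉v)))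
      (𝟙-× (avoidsOnto? (v ∷ʳ z)) (¬? (z ∈? v)))

  ontoCount≡G : ∀ n → ontoCount K n ≡ G n 0
  ontoCount≡G zero    = 𝟙-no (avoidsOnto? []) (empty-not-onto ∘ proj₂)
  ontoCount≡G (suc n) = trans (sumWords-∷ʳ K n (𝟙 ∘ avoidsOnto?)) (sumWords-cong K n (λ v → ∑-cong K (λ z →
    sym (trans (cong (𝟙 (avoidsOnto? (v ∷ʳ z)) *_) (𝟙-yes ((z ∈? v) →-dec (0 ≤? toℕ z)) (λ _ → z≤n)))
               (NP.*-identityʳ (𝟙 (avoidsOnto? (v ∷ʳ z))))))))

  G-split : ∀ n b → G (suc n) b ≡ c (suc n) K + T n b
  G-split n b = begin
    G (suc n) b
      ≡⟨ sumWords-cong K n (λ v → trans (∑-cong K (new-or-repeat v)) (∑-distrib-+ (endsNew v) (endsRepeat b v))) ⟩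
    sumWords K n (λ v → ∑[ z < K ] endsNew v z + ∑[ z < K ] endsRepeat b v z)
      ≡⟨ sumWords-+ K n (λ v → ∑[ z < K ] endsNew v z) (λ v → ∑[ z < K ] endsRepeat b v z) ⟩
    sumWords K n (λ v → ∑[ z < K ] endsNew v z) + T n b
      ≡⟨ cong (_+ T n b) (c-suc n) ⟨
    c (suc n) K + T n b ∎
    where
    new-or-repeat : ∀ {n} (v : Vec (Fin K) n) z → endsFrom b v z ≡ endsNew v z + endsRepeat b v z
    new-or-repeat v z = trans (cong (𝟙 (avoidsOnto? (v ∷ʳ z)) *_) (𝟙-→ (z ∈? v) (b ≤? toℕ z)))
                              (NP.*-distribˡ-+ (𝟙 (avoidsOnto? (v ∷ʳ z))) _ _)

  -- The key step.  For w = v ∷ʳ y, appending a repeated letter z ≥ b gives an avoiding onto word iff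
  -- w is avoiding and onto and z < y in case y is a repeat, i.e. iff w counts for G (n+1) (z+1).
  repeat-∷ʳ : ∀ {n} b (v : Vec (Fin K) n) y z →
              endsRepeat b (v ∷ʳ y) z ≡ 𝟙 (b ≤? toℕ z) * endsFrom (suc (toℕ z)) v y
  repeat-∷ʳ b v y z = begin
    𝟙 (avoidsOnto? w′) * (𝟙 (z ∈? w) * 𝟙 (b ≤? toℕ z))
      ≡⟨ cong (𝟙 (avoidsOnto? w′) *_) (𝟙-× (z ∈? w) (b ≤? toℕ z)) ⟨
    𝟙 (avoidsOnto? w′) * 𝟙 (z ∈? w ×-dec b ≤? toℕ z)
      ≡⟨ 𝟙-× (avoidsOnto? w′) (z ∈? w ×-dec b ≤? toℕ z) ⟨
    𝟙 (avoidsOnto? w′ ×-dec (z ∈? w ×-dec b ≤? toℕ z))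
      ≡⟨ 𝟙-cong (avoidsOnto? w′ ×-dec (z ∈? w ×-dec b ≤? toℕ z)) (b ≤? toℕ z ×-dec (avoidsOnto? w ×-dec drops?))
                equivalent ⟩
    𝟙 (b ≤? toℕ z ×-dec (avoidsOnto? w ×-dec drops?))
      ≡⟨ 𝟙-× (b ≤? toℕ z) (avoidsOnto? w ×-dec drops?) ⟩
    𝟙 (b ≤? toℕ z) * 𝟙 (avoidsOnto? w ×-dec drops?)
      ≡⟨ cong (𝟙 (b ≤? toℕ z) *_) (𝟙-× (avoidsOnto? w) drops?) ⟩
    𝟙 (b ≤? toℕ z) * endsFrom (suc (toℕ z)) v y ∎
    where
    w  = v ∷ʳ y
    w′ = w ∷ʳ z
    drops? = (y ∈? v) →-dec (suc (toℕ z) ≤? toℕ y)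

    equivalent : ((Avoids w′ × Surjective w′) × (z ∈ w × b ≤ toℕ z))
               ⇔ (b ≤ toℕ z × ((Avoids w × Surjective w) × (y ∈ v → z F.< y)))
    equivalent = mk⇔
      (λ ((av′ , onto′) , z∈w , b≤z) → let (av , drop) = to (avoids-∷ʳ∷ʳ v y z) av′
                                       in b≤z , (av , to (onto-∷ʳ w z z∈w) onto′) , drop)
      (λ (b≤z , (av , onto) , drop) → (from (avoids-∷ʳ∷ʳ v y z) (av , drop) , from (onto-∷ʳ w z (onto z)) onto)
                                    , onto z , b≤z)

  T-rec : ∀ n b → T n b ≡ sumFrom b K (λ i → G n (suc i))
  T-rec zero    b = begin
    ∑[ z < K ] (𝟙 (avoidsOnto? ([] ∷ʳ z)) * 0)  ≡⟨ ∑-cong K (NP.*-zeroʳ ∘ 𝟙 ∘ avoidsOnto? ∘ ([] ∷ʳ_)) ⟩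
    ∑[ z < K ] 0                               ≡⟨ ∑-cong K (λ z → NP.*-zeroʳ (𝟙 (b ≤? toℕ z))) ⟨
    sumFrom b K (λ i → G 0 (suc i))            ∎
  T-rec (suc n) b = begin
    sumWords K (suc n) (λ w → ∑[ z < K ] endsRepeat b w z)
      ≡⟨ sumWords-∷ʳ K n (λ w → ∑[ z < K ] endsRepeat b w z) ⟩
    sumWords K n (λ v → ∑[ y < K ] ∑[ z < K ] endsRepeat b (v ∷ʳ y) z)
      ≡⟨ sumWords-cong K n (λ v → trans (∑-cong K (λ y → ∑-cong K (repeat-∷ʳ b v y))) (∑-comm (summand v))) ⟩
    sumWords K n (λ v → ∑[ z < K ] ∑[ y < K ] summand v y z)
      ≡⟨ sumWords-∑-comm K n K (λ v z → ∑[ y < K ] summand v y z) ⟩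
    ∑[ z < K ] sumWords K n (λ v → ∑[ y < K ] summand v y z)
      ≡⟨ ∑-cong K factor-out ⟩
    sumFrom b K (λ i → G (suc n) (suc i)) ∎
    where
    summand : Vec (Fin K) n → Fin K → Fin K → ℕ
    summand v y z = 𝟙 (b ≤? toℕ z) * endsFrom (suc (toℕ z)) v y

    factor-out : ∀ z → sumWords K n (λ v → ∑[ y < K ] summand v y z)
                     ≡ 𝟙 (b ≤? toℕ z) * G (suc n) (suc (toℕ z))
    factor-out z = trans
      (sumWords-cong K n (λ v → sym (*-distribˡ-sum (𝟙 (b ≤? toℕ z)) (endsFrom (suc (toℕ z)) v))))
      (sumWords-*ˡ K n (𝟙 (b ≤? toℕ z)) (λ v → ∑[ y < K ] endsFrom (suc (toℕ z)) v y))

  G-rec : ∀ n b → G (suc n) b ≡ c (suc n) K + sumFrom b K (λ i → G n (suc i))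
  G-rec n b = trans (G-split n b) (cong (c (suc n) K +_) (T-rec n b))

  G-new : ∀ n b → K ≤ b → G (suc n) b ≡ c (suc n) K
  G-new n b K≤b = begin
    G (suc n) b                  ≡⟨ G-rec n b ⟩
    c (suc n) K + sumFrom b K g  ≡⟨ cong (c (suc n) K +_) (sumFrom-empty b K g K≤b) ⟩
    c (suc n) K + 0              ≡⟨ NP.+-identityʳ (c (suc n) K) ⟩
    c (suc n) K                  ∎
    where
    g = λ i → G n (suc i)

  -- Lowering the bound b < K by one admits the words ending in a repeat equal to b.
  G-step : ∀ n b → b < K → G (suc n) b ≡ G (suc n) (suc b) + G n (suc b)
  G-step n b b<K = begin
    G (suc n) b                                ≡⟨ G-rec n b ⟩
    c (suc n) K + sumFrom b K g                ≡⟨ cong (c (suc n) K +_) (sumFrom-first b K g b<K) ⟩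
    c (suc n) K + (g b + sumFrom (suc b) K g)  ≡⟨ +-move-middle (c (suc n) K) (g b) (sumFrom (suc b) K g) ⟩
    (c (suc n) K + sumFrom (suc b) K g) + g b  ≡⟨ cong (_+ g b) (G-rec n (suc b)) ⟨
    G (suc n) (suc b) + G n (suc b)            ∎
    where
    g = λ i → G n (suc i)

  binomConv : ℕ → ℕ → ℕ
  binomConv r n = ∑[ j < suc n ] ((r C toℕ j) * c (n ∸ toℕ j) K)

  binomConv-0 : ∀ r → binomConv r 0 ≡ 0
  binomConv-0 r = trans (NP.+-identityʳ ((r C 0) * c 0 K)) (trans (cong ((r C 0) *_) c-0) (NP.*-zeroʳ (r C 0)))

  binomConv-top : ∀ n → binomConv 0 (suc n) ≡ c (suc n) K
  binomConv-top n = trans (cong₂ _+_ (NP.*-identityˡ (c (suc n) K)) (sum-replicate-zero (suc n)))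
                          (NP.+-identityʳ (c (suc n) K))

  -- Pascal's rule, from (1+x)^(r+1) = (1+x)^r + x (1+x)^r.
  binomConv-pascal : ∀ r n → binomConv (suc r) (suc n) ≡ binomConv r (suc n) + binomConv r n
  binomConv-pascal r n = begin
    c₀ + ∑[ j < suc n ] ((suc r C suc (toℕ j)) * cₙ j)
      ≡⟨ cong (c₀ +_) (∑-cong (suc n) (λ j → cong (_* cₙ j) (sym (nCk+nC[k+1]≡[n+1]C[k+1] r (toℕ j))))) ⟩
    c₀ + ∑[ j < suc n ] ((r C toℕ j + r C suc (toℕ j)) * cₙ j)
      ≡⟨ cong (c₀ +_) (trans (∑-cong (suc n) (λ j → NP.*-distribʳ-+ (cₙ j) (r C toℕ j) (r C suc (toℕ j))))
                             (∑-distrib-+ {suc n} lower upper)) ⟩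
    c₀ + (binomConv r n + ∑[ j < suc n ] upper j)
      ≡⟨ +-move-middle c₀ (binomConv r n) (∑[ j < suc n ] upper j) ⟩
    binomConv r (suc n) + binomConv r n ∎
    where
    c₀ = 1 * c (suc n) K
    cₙ lower upper : Fin (suc n) → ℕ
    cₙ    j = c (n ∸ toℕ j) K
    lower j = (r C toℕ j) * cₙ j
    upper j = (r C suc (toℕ j)) * cₙ j

  G-formula : ∀ n b d → b + d ≡ K → G n b ≡ binomConv d n
  G-formula zero    b d       _       = sym (binomConv-0 d)
  G-formula (suc n) b zero    b+0≡K   =
    trans (G-new n b (NP.≤-reflexive (trans (sym b+0≡K) (NP.+-identityʳ b)))) (sym (binomConv-top n))
  G-formula (suc n) b (suc d) b+d+1≡K = begin
    G (suc n) b                          ≡⟨ G-step n b b<K ⟩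
    G (suc n) (suc b) + G n (suc b)      ≡⟨ cong₂ _+_ (G-formula (suc n) (suc b) d b+1+d≡K)
                                                      (G-formula n (suc b) d b+1+d≡K) ⟩
    binomConv d (suc n) + binomConv d n  ≡⟨ binomConv-pascal d n ⟨
    binomConv (suc d) (suc n)            ∎
    where
    b+1+d≡K = trans (sym (NP.+-suc b d)) b+d+1≡K
    b<K = subst (b <_) b+d+1≡K (NP.m<m+n b z<s)

  ontoCount-formula : ∀ n → ontoCount K n ≡ conv (K C_) (λ i → c i K) n
  ontoCount-formula n = begin
    ontoCount K n                ≡⟨ ontoCount≡G n ⟩
    G n 0                        ≡⟨ G-formula n 0 K refl ⟩
    binomConv K n                ≡⟨ conv≡∑ (K C_) (λ i → c i K) n ⟨
    conv (K C_) (λ i → c i K) n  ∎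

-- s(k,n) is the coefficient of x^n in (1+x)^k C_k(x); for k = 0 only the empty word is onto.
ontoCount-formula : ∀ k n → ontoCount k n ≡ conv (k C_) (λ i → c i k) n
ontoCount-formula zero    zero    = refl
ontoCount-formula zero    (suc n) = sym (trans (conv≡∑ (0 C_) (λ i → c i 0) (suc n)) (sum-replicate-zero (suc n)))
ontoCount-formula (suc k) n       = OntoWords.ontoCount-formula k n

mainTheorem11 : ∀ (m k : ℕ) → 1 ≤ m → k ≤ m → ∀ (n : ℕ) → countWords m k n ≡ rhsCoeff m k n
mainTheorem11 m k _ _ n = begin
  countWords m k n            ≡⟨ count-allWords m n (good? k) ⟩
  sumWords m n (𝟙 ∘ good? k)  ≡⟨ ChooseAlphabet.count-exact Avoids avoids? avoids-punchIn k n m ⟩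
  (m C k) * ontoCount k n     ≡⟨ cong ((m C k) *_) (ontoCount-formula k n) ⟩
  rhsCoeff m k n              ∎
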